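{- Let $q$ be a complex number with $q\neq 0,1$, let $m,r$ be complex numbers, and write $[j]_q=\frac{q^j-1}{q-1}$. For all integers $0\le k\le n$, the $(q,r)$-Whitney numbers of the second kind satisfy $$W_{m,r,q}(n,k)=q^{\binom{k}{2}}\sum_{c_0+c_1+\cdots+c_k=n-k}\ \prod_{j=0}^{k}\big(m[j]_q+r\big)^{c_j},$$ where the sum runs over all tuples $(c_0,\dots,c_k)$ of non-negative integers with $c_0+\cdots+c_k=n-k$.
   Context: The $(q,r)$-Whitney numbers of the second kind $W_{m,r,q}(n,k)$ are defined as the coefficients in $(ma^\dagger a+r)^n=\sum_{k=0}^{n}m^kW_{m,r,q}(n,k)(a^\dagger)^k a^k$, where $a^\dagger,a$ are $q$-boson operators satisfying $aa^\dagger-qa^\dagger a=1$. Equivalently, they are the unique numbers with $W_{m,r,q}(0,0)=1$, $W_{m,r,q}(n,k)=0$ for $k<0$ or $k>n$, and the recurrence $W_{m,r,q}(n+1,k)=q^{k-1}W_{m,r,q}(n,k-1)+(m[k]_q+r)W_{m,r,q}(n,k)$ for $n\ge 0$. -}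

module Defs where

open import Level using (Level)
open import Data.Nat as ℕ using (ℕ; zero; suc)
open import Data.Fin using (Fin; toℕ)
open import Data.Vec using (Vec; []; _∷_; foldr; tabulate; lookup)
open import Data.List using (List; []; _∷_; concatMap; filter; upTo)
open import Data.List as List using ()
open import Relation.Binary.PropositionalEquality using (_≡_)
open import Algebra.Bundles using (CommutativeRing)

module _ {c ℓ : Level} (R : CommutativeRing c ℓ) where
  open CommutativeRing R using (Carrier; _+_; _*_; 0#; 1#)

  pow : Carrier → ℕ → Carrier
  pow x zero = 1#
  pow x (suc n) = x * pow x n

  -- [j]_q = 1 + q + ... + q^(j-1)  (= (q^j - 1)/(q - 1) when q ≠ 1 in a field)
  qint : Carrier → ℕ → Carrier
  qint q zero = 0#
  qint q (suc j) = 1# + q * qint q j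

  -- (q,r)-Whitney numbers of the second kind, via the defining recurrence
  -- W(0,0)=1, W(n,k)=0 for k<0 or k>n,
  -- W(n+1,k) = q^(k-1) W(n,k-1) + (m[k]_q + r) W(n,k)
  W : (q m r : Carrier) → ℕ → ℕ → Carrier
  W q m r zero zero = 1#
  W q m r zero (suc k) = 0#
  W q m r (suc n) zero = (m * qint q zero + r) * W q m r n zero
  W q m r (suc n) (suc k) =
    pow q k * W q m r n k + (m * qint q (suc k) + r) * W q m r n (suc k)

  lsum : List Carrier → Carrier
  lsum = List.foldr _+_ 0#

boundedVecs : (N len : ℕ) → List (Vec ℕ len)
boundedVecs N zero = [] ∷ []
boundedVecs N (suc len) =
  concatMap (λ x → List.map (x ∷_) (boundedVecs N len)) (upTo (suc N))

vsum : ∀ {len} → Vec ℕ len → ℕ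
vsum = foldr _ ℕ._+_ 0

compositions : (N k : ℕ) → List (Vec ℕ (suc k))
compositions N k = filter (λ v → vsum v ℕ.≟ N) (boundedVecs N (suc k))

module _ {c ℓ : Level} (R : CommutativeRing c ℓ) where
  open CommutativeRing R using (Carrier; _+_; _*_; 0#; 1#)

  termProd : (q m r : Carrier) (k : ℕ) → Vec ℕ (suc k) → Carrier
  termProd q m r k cs =
    foldr _ _*_ 1# (tabulate (λ (j : Fin (suc k)) →
      pow R (m * qint R q (toℕ j) + r) (lookup cs j)))

  compSum : (q m r : Carrier) (N k : ℕ) → Carrier
  compSum q m r N k = lsum R (List.map (termProd q m r k) (compositions N k))

-- Closed form of the (q,r)-Whitney numbers of the second kind:
--   W(n,k) = q^(k choose 2) · h_{n-k}(a 0, …, a k),   a j = m[j]_q + r,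
-- where h_N is the complete homogeneous symmetric polynomial of degree N,
-- i.e. the sum over all compositions c_0+…+c_k = N of ∏ (a j)^(c_j).
--
-- The proof works in an arbitrary commutative ring and is organised in three parts.
--  1. h_N(g 0, …, g (len-1)) is defined by recursion on its FIRST variable
--     (either its exponent is 0, or lower it by one), and we show that the
--     same recursion holds for the LAST variable.
--  2. The last-variable recursion of h is exactly the Whitney recurrence once
--     the factor q^(k choose 2) is split off, so induction on n gives
--     W(k+N,k) = q^(k choose 2) · h_N(a 0, …, a k).
--  3. The list-based sum over compositions used in the statement satisfies
--     the first-variable recursion in its convolution form
--     h_N(g 0, …) = Σ_{x ≤ N} (g 0)^x · h_{N-x}(g 1, …),
--     hence agrees with h.
module Submission where

open import Defs
open import Level using (Level)
open import Data.Nat using (ℕ; _≤_; _∸_)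
open import Data.Nat.Combinatorics using (_C_)
open import Relation.Nullary using (¬_)
open import Algebra.Bundles using (CommutativeRing)

import Data.Nat as ℕ
import Data.Nat.Properties as ℕₚ
open import Data.Nat using (zero; suc; _<_; _≟_; z≤n; s≤s)
open import Data.Nat.Properties
  using (m≤n⇒m≤1+n; ≤-refl; ≤-trans; ≤-reflexive;
         m+[n∸m]≡n; m+n∸m≡n; m≤m+n; <⇒≱)
open import Data.Nat.Combinatorics using (nC1≡n; nCk+nC[k+1]≡[n+1]C[k+1])
open import Data.Fin using (Fin; toℕ)
open import Data.Vec using (Vec; []; _∷_; tabulate; lookup)
import Data.Vec as Vec
open import Data.List using (List; []; _∷_; _++_; concat; concatMap; filter; upTo; applyUpTo)
import Data.List as List
open import Data.List.Properties using (filter-++; filter-accept; filter-reject; map-∘; map-concatMap)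
open import Relation.Nullary using (yes; no)
open import Relation.Binary.PropositionalEquality as ≡ using (_≡_; _≢_)
open import Data.Maybe using (nothing)
open import Tactic.RingSolver using (solve-∀)
open import Tactic.RingSolver.Core.AlmostCommutativeRing using (AlmostCommutativeRing; fromCommutativeRing)

suc-C-2 : ∀ k → suc k C 2 ≡ k ℕ.+ k C 2
suc-C-2 k = ≡.trans (≡.sym (nCk+nC[k+1]≡[n+1]C[k+1] k 1)) (≡.cong (ℕ._+ k C 2) (nC1≡n k))

withSum : ∀ {len} → ℕ → List (Vec ℕ len) → List (Vec ℕ len)
withSum N = filter (λ v → vsum v ≟ N)

withSum-prefix : ∀ {len} x N → x ≤ N → (vs : List (Vec ℕ len)) →
  withSum N (List.map (x ∷_) vs) ≡ List.map (x ∷_) (withSum (N ∸ x) vs)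
withSum-prefix x N x≤N [] = ≡.refl
withSum-prefix x N x≤N (v ∷ vs) with vsum v ≟ N ∸ x
... | yes s≡N∸x =
  begin
    withSum N ((x ∷ v) ∷ List.map (x ∷_) vs)
  ≡⟨ filter-accept (λ u → vsum u ≟ N) {x ∷ v} {List.map (x ∷_) vs} (≡.trans (≡.cong (x ℕ.+_) s≡N∸x) (m+[n∸m]≡n x≤N)) ⟩
    (x ∷ v) ∷ withSum N (List.map (x ∷_) vs)
  ≡⟨ ≡.cong ((x ∷ v) ∷_) (withSum-prefix x N x≤N vs) ⟩
    List.map (x ∷_) (v ∷ withSum (N ∸ x) vs)
  ≡⟨ ≡.cong (List.map (x ∷_)) (≡.sym (filter-accept (λ u → vsum u ≟ N ∸ x) {v} {vs} s≡N∸x)) ⟩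
    List.map (x ∷_) (withSum (N ∸ x) (v ∷ vs))
  ∎
  where open ≡.≡-Reasoning
... | no s≢N∸x =
  begin
    withSum N ((x ∷ v) ∷ List.map (x ∷_) vs)
  ≡⟨ filter-reject (λ u → vsum u ≟ N) {x ∷ v} {List.map (x ∷_) vs} x+s≢N ⟩
    withSum N (List.map (x ∷_) vs)
  ≡⟨ withSum-prefix x N x≤N vs ⟩
    List.map (x ∷_) (withSum (N ∸ x) vs)
  ≡⟨ ≡.cong (List.map (x ∷_)) (≡.sym (filter-reject (λ u → vsum u ≟ N ∸ x) {v} {vs} s≢N∸x)) ⟩
    List.map (x ∷_) (withSum (N ∸ x) (v ∷ vs))
  ∎
  where
    open ≡.≡-Reasoning
    x+s≢N : x ℕ.+ vsum v ≢ N
    x+s≢N e = s≢N∸x (≡.trans (≡.sym (m+n∸m≡n x (vsum v))) (≡.cong (_∸ x) e))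

withSum-prefix-too-big : ∀ {len} x N → N < x → (vs : List (Vec ℕ len)) →
  withSum N (List.map (x ∷_) vs) ≡ []
withSum-prefix-too-big x N N<x [] = ≡.refl
withSum-prefix-too-big x N N<x (v ∷ vs) =
  ≡.trans (filter-reject (λ u → vsum u ≟ N) {x ∷ v} {List.map (x ∷_) vs} x+s≢N)
          (withSum-prefix-too-big x N N<x vs)
  where
    x+s≢N : x ℕ.+ vsum v ≢ N
    x+s≢N e = <⇒≱ N<x (≡.subst (x ≤_) e (m≤m+n x (vsum v)))

filter-concatMap : ∀ {len} N (φ : ℕ → List (Vec ℕ len)) xs →
  withSum N (concatMap φ xs) ≡ concatMap (λ x → withSum N (φ x)) xs
filter-concatMap N φ [] = ≡.refl
filter-concatMap N φ (x ∷ xs) =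
  ≡.trans (filter-++ (λ v → vsum v ≟ N) (φ x) (concatMap φ xs))
          (≡.cong (withSum N (φ x) ++_) (filter-concatMap N φ xs))

map-applyUpTo : ∀ {a b} {A : Set a} {B : Set b} (φ : A → B) (s : ℕ → A) n →
  List.map φ (applyUpTo s n) ≡ applyUpTo (λ x → φ (s x)) n
map-applyUpTo φ s zero = ≡.refl
map-applyUpTo φ s (suc n) = ≡.cong (φ (s 0) ∷_) (map-applyUpTo φ (λ x → s (suc x)) n)

module Exchange {c ℓ : Level} (R : CommutativeRing c ℓ) where
  ACR : AlmostCommutativeRing c ℓ
  ACR = fromCommutativeRing R (λ _ → nothing)
  open AlmostCommutativeRing ACR renaming (Carrier to A)

  exchange : ∀ (b X c₀ Z U : A) → b * X + c₀ * (Z + b * U) ≈ c₀ * Z + b * (X + c₀ * U)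
  exchange = solve-∀ ACR

module Development {c ℓ : Level} (R : CommutativeRing c ℓ) where
  open CommutativeRing R hiding (zero)
  open import Relation.Binary.Reasoning.Setoid setoid

  open Exchange R

  factor : ∀ Q E X b Y → Q * (E * X) + b * ((Q * E) * Y) ≈ (Q * E) * (X + b * Y)
  factor Q E X b Y =
    trans (+-cong (sym (*-assoc Q E X)) b-inside) (sym (distribˡ (Q * E) X (b * Y)))
    where
      b-inside : b * ((Q * E) * Y) ≈ (Q * E) * (b * Y)
      b-inside = trans (sym (*-assoc b _ Y)) (trans (*-congʳ (*-comm b _)) (*-assoc _ b Y))

  pull-left : ∀ c f k C → (c * f) * k + c * C ≈ c * (f * k + C)
  pull-left c f k C = trans (+-congʳ (*-assoc c f k)) (sym (distribˡ c _ _))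

  pow-+ : ∀ x a b → pow R x (a ℕ.+ b) ≈ pow R x a * pow R x b
  pow-+ x zero b = sym (*-identityˡ _)
  pow-+ x (suc a) b = trans (*-congˡ (pow-+ x a b)) (sym (*-assoc _ _ _))

  pow-suc-C-2 : ∀ q k → pow R q (suc k C 2) ≈ pow R q k * pow R q (k C 2)
  pow-suc-C-2 q k = trans (reflexive (≡.cong (pow R q) (suc-C-2 k))) (pow-+ q k (k C 2))

  -- h N len g = complete homogeneous symmetric polynomial of degree N in
  -- g 0, …, g (len-1): the exponent of g 0 is either 0 or can be lowered by one.
  h : ℕ → ℕ → (ℕ → Carrier) → Carrier
  h zero len g = 1#
  h (suc N) zero g = 0#
  h (suc N) (suc len) g = h (suc N) len (λ i → g (suc i)) + g 0 * h N (suc len) g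

  -- The same recursion holds for the last variable g len (h is symmetric).
  h-last : ∀ len N g → h (suc N) (suc len) g ≈ h (suc N) len g + g len * h N (suc len) g
  h-last zero N g = refl
  h-last (suc l) N g =
    begin
      h (suc N) (suc l) g' + g 0 * h N (suc (suc l)) g
    ≈⟨ +-congʳ (h-last l N g') ⟩
      (h (suc N) l g' + b * h N (suc l) g') + g 0 * h N (suc (suc l)) g
    ≈⟨ +-assoc _ _ _ ⟩
      h (suc N) l g' + (b * h N (suc l) g' + g 0 * h N (suc (suc l)) g)
    ≈⟨ +-congˡ (swap-ends N) ⟩
      h (suc N) l g' + (g 0 * h N (suc l) g + b * h N (suc (suc l)) g)
    ≈⟨ sym (+-assoc _ _ _) ⟩
      h (suc N) (suc l) g + b * h N (suc (suc l)) g
    ∎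
    where
      g' : ℕ → Carrier
      g' i = g (suc i)
      b : Carrier
      b = g (suc l)
      -- lowering the first or the last exponent first gives the same total
      swap-ends : ∀ M → b * h M (suc l) g' + g 0 * h M (suc (suc l)) g
                        ≈ g 0 * h M (suc l) g + b * h M (suc (suc l)) g
      swap-ends zero = +-comm _ _
      swap-ends (suc M) =
        trans (+-congˡ (*-congˡ (h-last (suc l) M g))) (exchange b _ (g 0) _ _)

  module Whitney (q m r : Carrier) where
    a : ℕ → Carrier
    a j = m * qint R q j + r

    W-above-diagonal : ∀ n k → n ≤ k → W R q m r n (suc k) ≈ 0#
    W-above-diagonal zero k _ = refl
    W-above-diagonal (suc n) (suc k) (s≤s n≤k) =
      trans (+-cong (*-congˡ (W-above-diagonal n k n≤k))
                    (*-congˡ (W-above-diagonal n (suc k) (m≤n⇒m≤1+n n≤k))))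
        (trans (+-cong (zeroʳ _) (zeroʳ _)) (+-identityʳ _))

    W-closed-form : ∀ k N → W R q m r (k ℕ.+ N) k ≈ pow R q (k C 2) * h N (suc k) a
    W-closed-form zero zero = sym (*-identityˡ _)
    W-closed-form zero (suc N) =
      begin
        a 0 * W R q m r N 0
      ≈⟨ *-congˡ (trans (W-closed-form zero N) (*-identityˡ _)) ⟩
        a 0 * h N 1 a
      ≈⟨ sym (trans (*-identityˡ _) (+-identityˡ _)) ⟩
        1# * (0# + a 0 * h N 1 a)
      ∎
    W-closed-form (suc k) zero =
      begin
        pow R q k * W R q m r (k ℕ.+ 0) k + a (suc k) * W R q m r (k ℕ.+ 0) (suc k)
      ≈⟨ +-cong (*-congˡ (W-closed-form k 0))
                (*-congˡ (W-above-diagonal (k ℕ.+ 0) k (≤-reflexive (ℕₚ.+-identityʳ k)))) ⟩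
        pow R q k * (pow R q (k C 2) * 1#) + a (suc k) * 0#
      ≈⟨ trans (+-congˡ (zeroʳ _)) (+-identityʳ _) ⟩
        pow R q k * (pow R q (k C 2) * 1#)
      ≈⟨ sym (*-assoc _ _ _) ⟩
        (pow R q k * pow R q (k C 2)) * 1#
      ≈⟨ *-congʳ (sym (pow-suc-C-2 q k)) ⟩
        pow R q (suc k C 2) * 1#
      ∎
    W-closed-form (suc k) (suc M) =
      begin
        pow R q k * W R q m r (k ℕ.+ suc M) k + a (suc k) * W R q m r (k ℕ.+ suc M) (suc k)
      ≈⟨ +-cong (*-congˡ (W-closed-form k (suc M))) (*-congˡ previous-column) ⟩
        pow R q k * (pow R q (k C 2) * h (suc M) (suc k) a)
          + a (suc k) * (pow R q (suc k C 2) * h M (suc (suc k)) a)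
      ≈⟨ +-congˡ (*-congˡ (*-congʳ (pow-suc-C-2 q k))) ⟩
        pow R q k * (pow R q (k C 2) * h (suc M) (suc k) a)
          + a (suc k) * ((pow R q k * pow R q (k C 2)) * h M (suc (suc k)) a)
      ≈⟨ factor _ _ _ _ _ ⟩
        (pow R q k * pow R q (k C 2)) * (h (suc M) (suc k) a + a (suc k) * h M (suc (suc k)) a)
      ≈⟨ *-cong (sym (pow-suc-C-2 q k)) (sym (h-last (suc k) M a)) ⟩
        pow R q (suc k C 2) * h (suc M) (suc (suc k)) a
      ∎
      where
        previous-column : W R q m r (k ℕ.+ suc M) (suc k) ≈ pow R q (suc k C 2) * h M (suc (suc k)) a
        previous-column = ≡.subst (λ n → W R q m r n (suc k) ≈ pow R q (suc k C 2) * h M (suc (suc k)) a)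
                                  (≡.sym (ℕₚ.+-suc k M)) (W-closed-form (suc k) M)

  conv : (ℕ → Carrier) → (ℕ → Carrier) → ℕ → Carrier
  conv f k zero = f 0 * k 0
  conv f k (suc N) = f 0 * k (suc N) + conv (λ x → f (suc x)) k N

  conv-scale : ∀ c f k N → conv (λ x → c * f x) k N ≈ c * conv f k N
  conv-scale c f k zero = *-assoc _ _ _
  conv-scale c f k (suc N) =
    trans (+-congˡ (conv-scale c (λ x → f (suc x)) k N)) (pull-left _ _ _ _)

  conv-cong : ∀ f k k′ N → (∀ y → y ≤ N → k y ≈ k′ y) → conv f k N ≈ conv f k′ N
  conv-cong f k k′ zero e = *-congˡ (e 0 z≤n)
  conv-cong f k k′ (suc N) e =
    +-cong (*-congˡ (e (suc N) ≤-refl))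
           (conv-cong (λ x → f (suc x)) k k′ N (λ y p → e y (m≤n⇒m≤1+n p)))

  -- Sorting the monomials of h by the exponent x of g 0.
  h-conv : ∀ N len g → h N (suc len) g ≈ conv (pow R (g 0)) (λ y → h y len (λ i → g (suc i))) N
  h-conv zero len g = sym (*-identityˡ _)
  h-conv (suc N) len g =
    trans (+-congˡ (*-congˡ (h-conv N len g)))
      (trans (+-congˡ (sym (conv-scale (g 0) (pow R (g 0)) _ N)))
             (+-congʳ (sym (*-identityˡ _))))

  Σ : List Carrier → Carrier
  Σ = lsum R

  Σ-++ : ∀ xs ys → Σ (xs ++ ys) ≈ Σ xs + Σ ys
  Σ-++ [] ys = sym (+-identityˡ _)
  Σ-++ (x ∷ xs) ys = trans (+-congˡ (Σ-++ xs ys)) (sym (+-assoc _ _ _))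

  Σ-concat : ∀ xss → Σ (concat xss) ≈ Σ (List.map Σ xss)
  Σ-concat [] = refl
  Σ-concat (xs ∷ xss) = trans (Σ-++ xs (concat xss)) (+-congˡ (Σ-concat xss))

  Σ-scale : ∀ {A : Set} c (φ : A → Carrier) xs →
    Σ (List.map (λ x → c * φ x) xs) ≈ c * Σ (List.map φ xs)
  Σ-scale c φ [] = sym (zeroʳ c)
  Σ-scale c φ (x ∷ xs) = trans (+-congˡ (Σ-scale c φ xs)) (sym (distribˡ c _ _))

  Σ-zero : ∀ M (t : ℕ → Carrier) → (∀ x → t x ≈ 0#) → Σ (applyUpTo t M) ≈ 0#
  Σ-zero zero t _ = refl
  Σ-zero (suc M) t e = trans (+-cong (e 0) (Σ-zero M (λ x → t (suc x)) (λ x → e (suc x))))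
                             (+-identityʳ _)

  Σ-conv : ∀ M N f k (t : ℕ → Carrier) → N < M →
    (∀ x → x ≤ N → t x ≈ f x * k (N ∸ x)) → (∀ x → N < x → t x ≈ 0#) →
    Σ (applyUpTo t M) ≈ conv f k N
  Σ-conv (suc M) zero f k t _ low high =
    trans (+-cong (low 0 z≤n) (Σ-zero M (λ x → t (suc x)) (λ x → high (suc x) (s≤s z≤n))))
          (+-identityʳ _)
  Σ-conv (suc M) (suc N) f k t (s≤s N<M) low high =
    +-cong (low 0 z≤n)
           (Σ-conv M N (λ x → f (suc x)) k (λ x → t (suc x)) N<M
                   (λ x x≤N → low (suc x) (s≤s x≤N)) (λ x N<x → high (suc x) (s≤s N<x)))

  -- ∏_j (g j)^(v j), and the sum of these monomials over the vectors with
  -- entries ≤ B summing to N; compSum is the case B = N.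
  monomial : (ℕ → Carrier) → ∀ {len} → Vec ℕ len → Carrier
  monomial g {len} v =
    Vec.foldr _ _*_ 1# (tabulate (λ (j : Fin len) → pow R (g (toℕ j)) (lookup v j)))

  monomialSum : ℕ → ℕ → ℕ → (ℕ → Carrier) → Carrier
  monomialSum B N len g = Σ (List.map (monomial g) (withSum N (boundedVecs B len)))

  first-exponent≤ : ∀ {len} g x N → x ≤ N → (vs : List (Vec ℕ len)) →
    Σ (List.map (monomial g) (withSum N (List.map (x ∷_) vs)))
      ≈ pow R (g 0) x * Σ (List.map (monomial (λ i → g (suc i))) (withSum (N ∸ x) vs))
  first-exponent≤ g x N x≤N vs =
    begin
      Σ (List.map (monomial g) (withSum N (List.map (x ∷_) vs)))
    ≡⟨ ≡.cong (λ l → Σ (List.map (monomial g) l)) (withSum-prefix x N x≤N vs) ⟩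
      Σ (List.map (monomial g) (List.map (x ∷_) (withSum (N ∸ x) vs)))
    ≡⟨ ≡.cong Σ (≡.sym (map-∘ (withSum (N ∸ x) vs))) ⟩
      Σ (List.map (λ v → pow R (g 0) x * monomial (λ i → g (suc i)) v) (withSum (N ∸ x) vs))
    ≈⟨ Σ-scale (pow R (g 0) x) (monomial (λ i → g (suc i))) (withSum (N ∸ x) vs) ⟩
      pow R (g 0) x * Σ (List.map (monomial (λ i → g (suc i))) (withSum (N ∸ x) vs))
    ∎

  first-exponent> : ∀ {len} g x N → N < x → (vs : List (Vec ℕ len)) →
    Σ (List.map (monomial g) (withSum N (List.map (x ∷_) vs))) ≈ 0#
  first-exponent> g x N N<x vs =
    reflexive (≡.cong (λ l → Σ (List.map (monomial g) l)) (withSum-prefix-too-big x N N<x vs))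

  monomialSum-conv : ∀ B N len g → N ≤ B →
    monomialSum B N (suc len) g ≈ conv (pow R (g 0)) (λ y → monomialSum B y len (λ i → g (suc i))) N
  monomialSum-conv B N len g N≤B =
    begin
      Σ (List.map (monomial g) (withSum N (concatMap prefixed (upTo (suc B)))))
    ≡⟨ ≡.cong (λ l → Σ (List.map (monomial g) l)) (filter-concatMap N prefixed (upTo (suc B))) ⟩
      Σ (List.map (monomial g) (concatMap (λ x → withSum N (prefixed x)) (upTo (suc B))))
    ≡⟨ ≡.cong Σ (map-concatMap (monomial g) (λ x → withSum N (prefixed x)) (upTo (suc B))) ⟩
      Σ (concat (List.map (λ x → List.map (monomial g) (withSum N (prefixed x))) (upTo (suc B))))
    ≈⟨ Σ-concat (List.map (λ x → List.map (monomial g) (withSum N (prefixed x))) (upTo (suc B))) ⟩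
      Σ (List.map Σ (List.map (λ x → List.map (monomial g) (withSum N (prefixed x))) (upTo (suc B))))
    ≡⟨ ≡.cong Σ (≡.sym (map-∘ (upTo (suc B)))) ⟩
      Σ (List.map t (upTo (suc B)))
    ≡⟨ ≡.cong Σ (map-applyUpTo t (λ x → x) (suc B)) ⟩
      Σ (applyUpTo t (suc B))
    ≈⟨ Σ-conv (suc B) N (pow R (g 0)) (λ y → monomialSum B y len (λ i → g (suc i))) t (s≤s N≤B)
              (λ x x≤N → first-exponent≤ g x N x≤N (boundedVecs B len))
              (λ x N<x → first-exponent> g x N N<x (boundedVecs B len)) ⟩
      conv (pow R (g 0)) (λ y → monomialSum B y len (λ i → g (suc i))) N
    ∎
    where
      prefixed : ℕ → List (Vec ℕ (suc len))
      prefixed x = List.map (x ∷_) (boundedVecs B len)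
      t : ℕ → Carrier
      t x = Σ (List.map (monomial g) (withSum N (prefixed x)))

  -- The list sum over compositions is h (entries ≤ B suffice since N ≤ B).
  monomialSum≈h : ∀ len B N g → N ≤ B → monomialSum B N len g ≈ h N len g
  monomialSum≈h zero B zero g _ = +-identityʳ _
  monomialSum≈h zero B (suc N) g _ = refl
  monomialSum≈h (suc len) B N g N≤B =
    begin
      monomialSum B N (suc len) g
    ≈⟨ monomialSum-conv B N len g N≤B ⟩
      conv (pow R (g 0)) (λ y → monomialSum B y len (λ i → g (suc i))) N
    ≈⟨ conv-cong _ _ _ N (λ y y≤N → monomialSum≈h len B y _ (≤-trans y≤N N≤B)) ⟩
      conv (pow R (g 0)) (λ y → h y len (λ i → g (suc i))) N
    ≈⟨ sym (h-conv N len g) ⟩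
      h N (suc len) g
    ∎

-- The closed form: compSum is by definition monomialSum (n ∸ k) (n ∸ k) (suc k) a.
theorem3 : {c ℓ : Level} (R : CommutativeRing c ℓ) →
    let open CommutativeRing R in
    (q m r : Carrier) → ¬ (q ≈ 0#) → ¬ (q ≈ 1#) →
    (n k : ℕ) → k ≤ n →
    W R q m r n k ≈ pow R q (k C 2) * compSum R q m r (n ∸ k) k
theorem3 R q m r _ _ n k k≤n =
  begin
    W R q m r n k
  ≡⟨ ≡.cong (λ n′ → W R q m r n′ k) (≡.sym (m+[n∸m]≡n k≤n)) ⟩
    W R q m r (k ℕ.+ (n ∸ k)) k
  ≈⟨ W-closed-form k (n ∸ k) ⟩
    pow R q (k C 2) * h (n ∸ k) (suc k) a
  ≈⟨ *-congˡ (sym (monomialSum≈h (suc k) (n ∸ k) (n ∸ k) a ≤-refl)) ⟩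
    pow R q (k C 2) * compSum R q m r (n ∸ k) k
  ∎
  where
    open CommutativeRing R
    open Development R
    open Whitney q m r
    open import Relation.Binary.Reasoning.Setoid setoid
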